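{- Let $G$ be a graph, $v\in V(G)$, and let $G+\{x\}$ be the graph obtained from $G$ by adding a new vertex $x$ adjacent only to $v$. Then $\mathcal{H}(G+\{x\})=\mathcal{H}(G)+\{x\}$, where $\mathcal{H}(G)+\{x\}$ is the graph obtained from $\mathcal{H}(G)$ by adding $x$ as a pendant vertex adjacent to (the image of) $v$.
   Context: All graphs are finite, simple, undirected, unweighted and connected. A graph is Helly if every family of pairwise intersecting disks $D(v,r)=\{u: d(u,v)\le r\}$ has a common vertex. The injective hull $\mathcal{H}(G)$ is the unique minimal Helly graph containing $G$ as an isometric subgraph; concretely its vertices are the functions $f:V(G)\to\mathbb{Z}_{\ge0}$ with $f(a)+f(b)\ge d_G(a,b)$ for all $a,b$ and such that for every $a$ there is $b$ with $f(a)+f(b)=d_G(a,b)$, two functions being adjacent iff $\max_a|f(a)-g(a)|=1$, with $G$ embedded via $z\mapsto d_G(z,\cdot)$. -}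

module Defs where

open import Data.Nat using (ℕ; zero; suc; _+_; _≤_; ∣_-_∣)
open import Data.Fin using (Fin; zero; suc; _≟_)
open import Relation.Nullary using (yes; no)
open import Data.Bool using (Bool; true; false; T)
open import Data.Vec using (Vec; lookup)
open import Data.Product using (Σ; ∃; _×_; _,_)
open import Data.Maybe using (Maybe; just; nothing)
open import Data.Empty using (⊥)
open import Relation.Binary.PropositionalEquality using (_≡_)

record Graph (n : ℕ) : Set where
  field
    adj   : Fin n → Fin n → Bool
    sym   : ∀ a b → adj a b ≡ adj b a
    irref : ∀ a → adj a a ≡ false
open Graph public

Adj : ∀ {n} → Graph n → Fin n → Fin n → Set
Adj G a b = T (adj G a b)

data Walk {n} (G : Graph n) : Fin n → Fin n → ℕ → Set where
  here : ∀ {a} → Walk G a a zero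
  step : ∀ {a c b k} → Adj G a c → Walk G c b k → Walk G a b (suc k)

Connected : ∀ {n} → Graph n → Set
Connected {n} G = ∀ (a b : Fin n) → ∃ λ k → Walk G a b k

IsDist : ∀ {n} → Graph n → Fin n → Fin n → ℕ → Set
IsDist G a b k = Walk G a b k × (∀ m → Walk G a b m → k ≤ m)

-- G + {x}: new vertex x = zero, old vertex a becomes suc a; x adjacent only to v.
addPendantAdj : ∀ {n} → Graph n → Fin n → Fin (suc n) → Fin (suc n) → Bool
addPendantAdj G v zero zero = false
addPendantAdj G v zero (suc b) with v ≟ b
... | yes _ = true
... | no _ = false
addPendantAdj G v (suc a) zero with v ≟ a
... | yes _ = true
... | no _ = false
addPendantAdj G v (suc a) (suc b) = adj G a b

private
  open import Relation.Binary.PropositionalEquality using (refl)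
  apSym : ∀ {n} (G : Graph n) v a b → addPendantAdj G v a b ≡ addPendantAdj G v b a
  apSym G v zero zero = refl
  apSym G v zero (suc b) with v ≟ b
  ... | yes _ = refl
  ... | no _ = refl
  apSym G v (suc a) zero with v ≟ a
  ... | yes _ = refl
  ... | no _ = refl
  apSym G v (suc a) (suc b) = sym G a b
  apIrr : ∀ {n} (G : Graph n) v a → addPendantAdj G v a a ≡ false
  apIrr G v zero = refl
  apIrr G v (suc a) = irref G a

addPendant : ∀ {n} → Graph n → Fin n → Graph (suc n)
addPendant G v = record { adj = addPendantAdj G v ; sym = apSym G v ; irref = apIrr G v }

-- Vertices of the injective hull H(G): functions f : V(G) → ℕ (as vectors) with
-- f(a)+f(b) ≥ d(a,b) for all a,b, and for each a some b with f(a)+f(b) = d(a,b).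
IsHullFn : ∀ {n} → Graph n → Vec ℕ n → Set
IsHullFn {n} G f =
  (∀ a b k → IsDist G a b k → k ≤ lookup f a + lookup f b) ×
  (∀ a → ∃ λ b → ∃ λ k → IsDist G a b k × lookup f a + lookup f b ≡ k)

record HullV {n} (G : Graph n) : Set where
  constructor hullV
  field
    fn  : Vec ℕ n
    .ok : IsHullFn G fn
open HullV public

HullAdj : ∀ {n} (G : Graph n) → HullV G → HullV G → Set
HullAdj {n} G f g =
  (∀ (a : Fin n) → ∣ lookup (fn f) a - lookup (fn g) a ∣ ≤ 1) ×
  (∃ λ (a : Fin n) → ∣ lookup (fn f) a - lookup (fn g) a ∣ ≡ 1)

IsImage : ∀ {n} (G : Graph n) → Fin n → HullV G → Set
IsImage G z u = ∀ a → IsDist G z a (lookup (fn u) a)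

-- H(G) + {x}: vertex set Maybe (HullV G), nothing = x, pendant at the image of v.
HullPlusAdj : ∀ {n} (G : Graph n) → Fin n → Maybe (HullV G) → Maybe (HullV G) → Set
HullPlusAdj G v nothing nothing = ⊥
HullPlusAdj G v nothing (just u) = IsImage G v u
HullPlusAdj G v (just u) nothing = IsImage G v u
HullPlusAdj G v (just u) (just w) = HullAdj G u w

-- A graph isomorphism H(G+{x}) ≅ H(G)+{x} which is the identity on G+{x}
-- (i.e. respects the canonical embeddings of G+{x} into both graphs).
record HullIso {n} (G : Graph n) (v : Fin n) : Set where
  field
    to      : HullV (addPendant G v) → Maybe (HullV G)
    from    : Maybe (HullV G) → HullV (addPendant G v)
    to∘from : ∀ u → to (from u) ≡ u
    from∘to : ∀ u → from (to u) ≡ u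
    adj-to  : ∀ u w → HullAdj (addPendant G v) u w → HullPlusAdj G v (to u) (to w)
    adj-from : ∀ u w → HullPlusAdj G v (to u) (to w) → HullAdj (addPendant G v) u w
    emb-x   : ∀ u → IsImage (addPendant G v) zero u → to u ≡ nothing
    emb-G   : ∀ z u → IsImage (addPendant G v) (suc z) u →
              ∃ λ w → to u ≡ just w × IsImage G z w

module Submission where

-- Write G⁺ = G + {x}, with x = zero and the old vertex a as suc a.  Distances in
-- G⁺ are those of G between old vertices, and d⁺(x, b) = d(v, b) + 1.  From this:
--   * the hull function of G⁺ with f(x) = 0 is d⁺(x, ·) = 0 ∷ (1 + d(v, ·)), since a
--     hull function vanishing at z is the distance function from z;
--   * every other hull function satisfies f(x) = f(v) + 1 (hull functions are
--     1-Lipschitz, and f(v) is attained against a vertex whose detour through x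
--     is longer), so it is determined by its restriction, which is a hull
--     function of G; conversely every f ∈ H(G) extends by f(x) = f(v) + 1.
-- Hence H(G⁺) = {d⁺(x, ·)} ⊎ H(G).  The extra coordinate is a shifted copy of the one at v,
-- so adjacency of extensions is adjacency in H(G), and d⁺(x, ·) is adjacent to
-- the extension of f exactly when f(v) = 0, i.e. when f is the image of v.

open import Defs hiding (sym)
open import Data.Nat using (ℕ; zero; suc; pred; _+_; _≤_; _<_; ∣_-_∣; z≤n; s≤s)
  renaming (_≟_ to _≟ℕ_)
open import Data.Nat.Properties
  using (≤-antisym; ≤-trans; ≤-refl; ≤-reflexive; ≤-pred; n≤1+n; ≮⇒≥; m≤n⇒m<n∨m≡n; n≤0⇒n≡0;
         +-comm; +-assoc; +-suc; +-identityʳ; m+n≡0⇒m≡0; +-cancelʳ-≤; +-monoʳ-≤; ∣-∣-comm; ∣n-n∣≡0;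
         module ≤-Reasoning)
open import Data.Fin using (Fin; zero; suc) renaming (_≟_ to _≟F_)
open import Data.Fin.Properties using (any?)
open import Data.Vec using (Vec; _∷_; lookup; tabulate)
open import Data.Vec.Properties using (lookup∘tabulate; tabulate∘lookup; tabulate-cong; ≡-dec)
open import Data.Bool using (T; T?)
open import Data.Unit using (tt)
open import Data.Empty using (⊥-elim)
open import Data.Sum using (inj₁; inj₂)
open import Data.Product using (∃; _×_; _,_; proj₁; proj₂)
open import Data.Maybe using (Maybe; just; nothing)
open import Relation.Nullary using (Dec; yes; no; ¬_)
open import Relation.Nullary.Decidable using (recompute; _×-dec_)
open import Relation.Binary.PropositionalEquality
  using (_≡_; refl; sym; trans; cong; subst; subst₂; module ≡-Reasoning)

-- Least number principle for a decidable predicate on ℕ: a witness k yields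
-- a least witness.  Needed to turn connectivity into actual distances.
module _ {P : ℕ → Set} (P? : ∀ m → Dec (P m)) where

  private
    search : ∀ i d → (∀ j → j < i → ¬ P j) → P (i + d) → ∃ λ m → P m × (∀ j → P j → m ≤ j)
    search i d below p with P? i
    ... | yes pi = i , pi , λ j pj → ≮⇒≥ (λ j<i → below j j<i pj)
    search i zero    below p | no ¬pi = ⊥-elim (¬pi (subst P (+-identityʳ i) p))
    search i (suc d) below p | no ¬pi = search (suc i) d below′ (subst P (+-suc i d) p)
      where
        below′ : ∀ j → j < suc i → ¬ P j
        below′ j (s≤s j≤i) with m≤n⇒m<n∨m≡n j≤i
        ... | inj₁ j<i  = below j j<i
        ... | inj₂ refl = ¬pi

  least-witness : ∀ k → P k → ∃ λ m → P m × (∀ j → P j → m ≤ j)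
  least-witness k = search 0 k (λ _ ())

module WalkProperties {n : ℕ} (H : Graph n) where

  _++ʷ_ : ∀ {a b c k l} → Walk H a b k → Walk H b c l → Walk H a c (k + l)
  here     ++ʷ w′ = w′
  step x w ++ʷ w′ = step x (w ++ʷ w′)

  adj-sym : ∀ {a b} → Adj H a b → Adj H b a
  adj-sym {a} {b} = subst T (Graph.sym H a b)

  reverse : ∀ {a b k} → Walk H a b k → Walk H b a k
  reverse here = here
  reverse {k = suc k} (step x w) =
    subst (Walk H _ _) (+-comm k 1) (reverse w ++ʷ step (adj-sym x) here)

  walk? : ∀ k a b → Dec (Walk H a b k)
  walk? zero a b with a ≟F b
  ... | yes refl = yes here
  ... | no a≢b   = no λ { here → a≢b refl }
  walk? (suc k) a b with any? (λ c → T? (adj H a c) ×-dec walk? k c b)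
  ... | yes (c , x , w) = yes (step x w)
  ... | no ∄c           = no λ { (step x w) → ∄c (_ , x , w) }

  dist-unique : ∀ {a b k l} → IsDist H a b k → IsDist H a b l → k ≡ l
  dist-unique (w , min) (w′ , min′) = ≤-antisym (min _ w′) (min′ _ w)

  dist-sym : ∀ {a b k} → IsDist H a b k → IsDist H b a k
  dist-sym (w , min) = reverse w , λ m w′ → min m (reverse w′)

  dist-triangle : ∀ {a b c k l m} → IsDist H a b k → IsDist H b c l → IsDist H a c m → m ≤ k + l
  dist-triangle (w , _) (w′ , _) (_ , min) = min _ (w ++ʷ w′)

  dist-self : ∀ {a} → IsDist H a a 0
  dist-self = here , λ _ _ → z≤n

  dist-self-zero : ∀ {a k} → IsDist H a a k → k ≡ 0
  dist-self-zero (_ , min) = n≤0⇒n≡0 (min 0 here)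

  distance-is-hull : ∀ (f : Vec ℕ n) z → (∀ a → IsDist H z a (lookup f a)) → IsHullFn H f
  distance-is-hull f z Df =
    (λ a b k D → dist-triangle (dist-sym (Df a)) (Df b) D) ,
    λ a → z , lookup f a , dist-sym (Df a) ,
          trans (cong (lookup f a +_) (dist-self-zero (Df z))) (+-identityʳ _)

module ConnectedDistances {n : ℕ} (H : Graph n) (connected : Connected H) where
  open WalkProperties H

  distance : ∀ a b → ∃ (IsDist H a b)
  distance a b = least-witness (λ k → walk? k a b) (proj₁ (connected a b)) (proj₂ (connected a b))

  -- Distances are unique natural numbers, so an irrelevant proof can be rebuilt.
  recompute-dist : ∀ {a b k} → .(IsDist H a b k) → IsDist H a b k
  recompute-dist {a} {b} {k} D =
    subst (IsDist H a b) (sym (recompute (k ≟ℕ proj₁ (distance a b)) (dist-unique D (proj₂ (distance a b)))))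
          (proj₂ (distance a b))

  hull-lipschitz : ∀ {f a b k} → IsHullFn H f → IsDist H a b k → lookup f a ≤ k + lookup f b
  hull-lipschitz {f} {a} {b} {k} (lower , tight) Dab with tight a
  ... | c , l , Dac , fa+fc≡l with distance b c
  ... | m , Dbc = +-cancelʳ-≤ (lookup f c) (lookup f a) (k + lookup f b) (begin
      lookup f a + lookup f c  ≡⟨ fa+fc≡l ⟩
      l                        ≤⟨ dist-triangle Dab Dbc Dac ⟩
      k + m                    ≤⟨ +-monoʳ-≤ k (lower b c m Dbc) ⟩
      k + (lookup f b + lookup f c) ≡⟨ sym (+-assoc k (lookup f b) (lookup f c)) ⟩
      k + lookup f b + lookup f c ∎)
    where open ≤-Reasoning

  hull-zero-is-distance : ∀ f → IsHullFn H f → ∀ z → lookup f z ≡ 0 → ∀ a → IsDist H z a (lookup f a)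
  hull-zero-is-distance f hull@(lower , _) z fz≡0 a with distance z a
  ... | k , Dza = subst (IsDist H z a) (≤-antisym k≤fa fa≤k) Dza
    where
      k≤fa : k ≤ lookup f a
      k≤fa = subst (λ t → k ≤ t + lookup f a) fz≡0 (lower z a k Dza)
      fa≤k : lookup f a ≤ k
      fa≤k = subst (lookup f a ≤_) (trans (cong (k +_) fz≡0) (+-identityʳ k))
                   (hull-lipschitz {f} hull (dist-sym Dza))

-- Vectors at ℓ∞-distance exactly one.  HullAdj G u w unfolds to this relation
-- on the underlying vectors of u and w.
UnitApart : ∀ {m} → Vec ℕ m → Vec ℕ m → Set
UnitApart {m} f g =
  (∀ (a : Fin m) → ∣ lookup f a - lookup g a ∣ ≤ 1) ×
  (∃ λ (a : Fin m) → ∣ lookup f a - lookup g a ∣ ≡ 1)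

unit-apart-irrefl : ∀ {m} (f : Vec ℕ m) → ¬ UnitApart f f
unit-apart-irrefl f (_ , a , one) with trans (sym (∣n-n∣≡0 (lookup f a))) one
... | ()

unit-apart-sym : ∀ {m} {f g : Vec ℕ m} → UnitApart f g → UnitApart g f
unit-apart-sym {f = f} {g} (close , a , one) =
  (λ b → subst (_≤ 1) (∣-∣-comm (lookup f b) (lookup g b)) (close b)) ,
  a , trans (∣-∣-comm (lookup g a) (lookup f a)) one

unit-apart-drop-copy : ∀ {m} (f g : Vec ℕ m) v →
  UnitApart (suc (lookup f v) ∷ f) (suc (lookup g v) ∷ g) → UnitApart f g
unit-apart-drop-copy f g v (close , zero  , one) = (λ a → close (suc a)) , v , one
unit-apart-drop-copy f g v (close , suc a , one) = (λ a → close (suc a)) , a , one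

unit-apart-add-copy : ∀ {m} (f g : Vec ℕ m) v →
  UnitApart f g → UnitApart (suc (lookup f v) ∷ f) (suc (lookup g v) ∷ g)
unit-apart-add-copy f g v (close , a , one) = close′ , suc a , one
  where
    close′ : ∀ b → ∣ lookup (suc (lookup f v) ∷ f) b - lookup (suc (lookup g v) ∷ g) b ∣ ≤ 1
    close′ zero    = close v
    close′ (suc b) = close b

∣1+n-n∣≡1 : ∀ d → ∣ suc d - d ∣ ≡ 1
∣1+n-n∣≡1 zero    = refl
∣1+n-n∣≡1 (suc d) = ∣1+n-n∣≡1 d

hullV-≡ : ∀ {n} {H : Graph n} {u w : HullV H} → fn u ≡ fn w → u ≡ w
hullV-≡ {u = hullV f _} {hullV .f _} refl = refl

module Pendant {n : ℕ} (G : Graph n) (connected : Connected G) (v : Fin n) where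
  open WalkProperties G
  open ConnectedDistances G connected

  G⁺ : Graph (suc n)
  G⁺ = addPendant G v

  module W⁺ = WalkProperties G⁺

  x-adj-v : Adj G⁺ zero (suc v)
  x-adj-v with v ≟F v
  ... | yes _  = tt
  ... | no v≢v = v≢v refl

  x-adj-only-v : ∀ {a} → Adj G⁺ zero (suc a) → v ≡ a
  x-adj-only-v {a} x~a with v ≟F a
  ... | yes v≡a = v≡a
  ... | no _    = ⊥-elim x~a

  lift : ∀ {a b k} → Walk G a b k → Walk G⁺ (suc a) (suc b) k
  lift here       = here
  lift (step e w) = step e (lift w)

  -- A walk of G⁺ between old vertices visits x only as a detour v → x → v,
  -- so it shortens to a walk of G; a walk leaving x first steps to v.
  shorten        : ∀ {a b k} → Walk G⁺ (suc a) (suc b) k → ∃ λ k′ → k′ ≤ k × Walk G a b k′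
  shorten-from-x : ∀ {b k} → Walk G⁺ zero (suc b) k → ∃ λ k′ → suc k′ ≤ k × Walk G v b k′
  shorten here = 0 , z≤n , here
  shorten {a} (step {c = zero} e w) with shorten-from-x w | x-adj-only-v {a} (W⁺.adj-sym {suc a} {zero} e)
  ... | k′ , k′<k , w′ | refl = k′ , ≤-trans (n≤1+n k′) (≤-trans k′<k (n≤1+n _)) , w′
  shorten (step {c = suc c} e w) with shorten w
  ... | k′ , k′≤k , w′ = suc k′ , s≤s k′≤k , step e w′
  shorten-from-x (step {c = zero} e w) = ⊥-elim e
  shorten-from-x (step {c = suc c} e w) with shorten w | x-adj-only-v e
  ... | k′ , k′≤k , w′ | refl = k′ , s≤s k′≤k , w′

  connected⁺ : Connected G⁺
  connected⁺ zero    zero    = 0 , here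
  connected⁺ zero    (suc b) = let (k , w) = connected v b in suc k , step x-adj-v (lift w)
  connected⁺ (suc a) zero    = let (k , w) = connected v a in suc k , W⁺.reverse (step x-adj-v (lift w))
  connected⁺ (suc a) (suc b) = let (k , w) = connected a b in k , lift w

  dist-lift : ∀ {a b k} → IsDist G a b k → IsDist G⁺ (suc a) (suc b) k
  dist-lift (w , min) = lift w , λ m w′ → let (m′ , m′≤m , w″) = shorten w′ in ≤-trans (min m′ w″) m′≤m

  dist-restrict : ∀ {a b k} → IsDist G⁺ (suc a) (suc b) k → IsDist G a b k
  dist-restrict {a} {b} (w , min) with shorten w
  ... | k′ , k′≤k , w′ = subst (Walk G a b) (≤-antisym k′≤k (min _ (lift w′))) w′ ,
                         λ m w″ → min m (lift w″)

  dist-from-x : ∀ {b d} → IsDist G v b d → IsDist G⁺ zero (suc b) (suc d)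
  dist-from-x (w , min) =
    step x-adj-v (lift w) , λ m w′ → let (m′ , m′<m , w″) = shorten-from-x w′ in ≤-trans (s≤s (min m′ w″)) m′<m

  dist-from-x⁻¹ : ∀ {b k} → IsDist G⁺ zero (suc b) k → ∃ λ d → k ≡ suc d × IsDist G v b d
  dist-from-x⁻¹ (w , min) with shorten-from-x w
  ... | k′ , k′<k , w′ = k′ , ≤-antisym (min (suc k′) (step x-adj-v (lift w′))) k′<k ,
                         w′ , λ m w″ → ≤-pred (≤-trans k′<k (min (suc m) (step x-adj-v (lift w″))))

  dist-to-x⁻¹ : ∀ {a k} → IsDist G⁺ (suc a) zero k → ∃ λ d → k ≡ suc d × IsDist G a v d
  dist-to-x⁻¹ D with dist-from-x⁻¹ (W⁺.dist-sym D)
  ... | d , k≡1+d , Dva = d , k≡1+d , dist-sym Dva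

  module C⁺ = ConnectedDistances G⁺ connected⁺

  hull-x-value : ∀ {f₀ fs} → IsHullFn G⁺ (suc f₀ ∷ fs) → f₀ ≡ lookup fs v
  hull-x-value {f₀} {fs} hull@(lower , tight) = ≤-antisym (≤-pred f₀≤fv) fv≤f₀
    where
      -- 1-Lipschitz along the edge xv.
      f₀≤fv : suc f₀ ≤ suc (lookup fs v)
      f₀≤fv = C⁺.hull-lipschitz {suc f₀ ∷ fs} hull (dist-from-x dist-self)
      -- f(v) is attained against some partner b.  If b = x then f(v) = 0; if b is
      -- old, the route x → v → b shows f(x) + f(b) ≥ f(v) + f(b) + 1.
      fv≤f₀ : lookup fs v ≤ f₀
      fv≤f₀ with tight (suc v)
      ... | zero , k , Dvx , fv+fx≡k with dist-to-x⁻¹ Dvx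
      ...   | d , refl , Dvv with dist-self-zero Dvv
      ...     | refl = subst (_≤ f₀) (sym fv≡0) z≤n
        where
          fv≡0 : lookup fs v ≡ 0
          fv≡0 = m+n≡0⇒m≡0 (lookup fs v) (cong pred (trans (sym (+-suc (lookup fs v) f₀)) fv+fx≡k))
      fv≤f₀ | suc b , k , Dvb , fv+fb≡k =
        +-cancelʳ-≤ (lookup fs b) (lookup fs v) f₀ (≤-pred (begin
          suc (lookup fs v + lookup fs b) ≡⟨ cong suc fv+fb≡k ⟩
          suc k                           ≤⟨ lower zero (suc b) (suc k) (dist-from-x (dist-restrict Dvb)) ⟩
          suc f₀ + lookup fs b            ∎))
        where open ≤-Reasoning

  -- Such a hull function restricts to a hull function of G: a tight pair
  -- (a, x) becomes the tight pair (a, v), because f(x) = f(v) + 1 = f(v) + d⁺(v, x).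
  hull-restrict : ∀ {f₀ fs} → IsHullFn G⁺ (suc f₀ ∷ fs) → IsHullFn G fs
  hull-restrict {f₀} {fs} hull@(lower , tight) = (λ a b k D → lower (suc a) (suc b) k (dist-lift D)) , tight′
    where
      tight′ : ∀ a → ∃ λ b → ∃ λ k → IsDist G a b k × lookup fs a + lookup fs b ≡ k
      tight′ a with tight (suc a)
      ... | suc b , k , Dab , eq = b , k , dist-restrict Dab , eq
      ... | zero  , k , Dax , eq with dist-to-x⁻¹ Dax
      ...   | d , refl , Dav = v , d , Dav , (begin
              lookup fs a + lookup fs v ≡⟨ cong (lookup fs a +_) (sym (hull-x-value hull)) ⟩
              lookup fs a + f₀          ≡⟨ cong pred (trans (sym (+-suc (lookup fs a) f₀)) eq) ⟩
              d                         ∎)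
        where open ≡-Reasoning

  hull-extend : ∀ {f} → IsHullFn G f → IsHullFn G⁺ (suc (lookup f v) ∷ f)
  hull-extend {f} (lower , tight) = lower⁺ , tight⁺
    where
      f⁺ : Vec ℕ (suc n)
      f⁺ = suc (lookup f v) ∷ f
      lower⁺ : ∀ p q k → IsDist G⁺ p q k → k ≤ lookup f⁺ p + lookup f⁺ q
      lower⁺ zero    zero    k D = subst (_≤ _) (sym (W⁺.dist-self-zero D)) z≤n
      lower⁺ zero    (suc b) k D with dist-from-x⁻¹ D
      ... | d , refl , Dvb = s≤s (lower v b d Dvb)
      lower⁺ (suc a) zero    k D with dist-to-x⁻¹ D
      ... | d , refl , Dav = subst (suc d ≤_) (sym (+-suc (lookup f a) (lookup f v))) (s≤s (lower a v d Dav))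
      lower⁺ (suc a) (suc b) k D = lower a b k (dist-restrict D)
      tight⁺ : ∀ p → ∃ λ q → ∃ λ k → IsDist G⁺ p q k × lookup f⁺ p + lookup f⁺ q ≡ k
      tight⁺ zero    with tight v
      ... | b , k , Dvb , eq = suc b , suc k , dist-from-x Dvb , cong suc eq
      tight⁺ (suc a) with tight a
      ... | b , k , Dab , eq = suc b , k , dist-lift Dab , eq

  dist-v : Fin n → ℕ
  dist-v a = proj₁ (distance v a)

  dist-x-old : Vec ℕ n
  dist-x-old = tabulate (λ a → suc (dist-v a))

  lookup-dist-x-old : ∀ {a d} → IsDist G v a d → lookup dist-x-old a ≡ suc d
  lookup-dist-x-old {a} Dva =
    trans (lookup∘tabulate (λ b → suc (dist-v b)) a) (cong suc (dist-unique (proj₂ (distance v a)) Dva))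

  x-image : Vec ℕ (suc n)
  x-image = 0 ∷ dist-x-old

  x-image-is-distance : ∀ p → IsDist G⁺ zero p (lookup x-image p)
  x-image-is-distance zero    = W⁺.dist-self
  x-image-is-distance (suc a) =
    subst (IsDist G⁺ zero (suc a)) (sym (lookup-dist-x-old (proj₂ (distance v a)))) (dist-from-x (proj₂ (distance v a)))

  hull-zero-at-x : ∀ {fs} → IsHullFn G⁺ (0 ∷ fs) → fs ≡ dist-x-old
  hull-zero-at-x {fs} hull = trans (sym (tabulate∘lookup fs)) (tabulate-cong fa≡1+dva)
    where
      fa≡1+dva : ∀ a → lookup fs a ≡ suc (dist-v a)
      fa≡1+dva a with dist-from-x⁻¹ (C⁺.hull-zero-is-distance (0 ∷ fs) hull zero refl (suc a))
      ... | d , fa≡1+d , Dva = trans fa≡1+d (cong suc (dist-unique Dva (proj₂ (distance v a))))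

  -- Hull vertices keep their proofs irrelevantly; the facts extracted from
  -- them are decidable equalities and can therefore be recomputed.
  x-value : ∀ {f₀ fs} → .(IsHullFn G⁺ (suc f₀ ∷ fs)) → f₀ ≡ lookup fs v
  x-value {f₀} {fs} hull = recompute (f₀ ≟ℕ lookup fs v) (hull-x-value hull)

  zero-at-x : ∀ {fs} → .(IsHullFn G⁺ (0 ∷ fs)) → fs ≡ dist-x-old
  zero-at-x {fs} hull = recompute (≡-dec _≟ℕ_ fs dist-x-old) (hull-zero-at-x hull)

  to : HullV G⁺ → Maybe (HullV G)
  to (hullV (zero ∷ fs) _)       = nothing
  to (hullV (suc f₀ ∷ fs) hull) = just (hullV fs (hull-restrict hull))

  from : Maybe (HullV G) → HullV G⁺
  from nothing                = hullV x-image (W⁺.distance-is-hull x-image zero x-image-is-distance)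
  from (just (hullV f hull)) = hullV (suc (lookup f v) ∷ f) (hull-extend hull)

  to∘from : ∀ u → to (from u) ≡ u
  to∘from nothing  = refl
  to∘from (just _) = refl

  from∘to : ∀ u → from (to u) ≡ u
  from∘to (hullV (zero ∷ fs) hull)   = hullV-≡ (cong (0 ∷_) (sym (zero-at-x hull)))
  from∘to (hullV (suc f₀ ∷ fs) hull) = hullV-≡ (cong (λ t → suc t ∷ fs) (sym (x-value hull)))

  -- A hull vertex adjacent to the image of x has value 1 at x, hence vanishes
  -- at v, hence (restricted to G) is the image of v.
  adjacent-x-image : ∀ {fs g₀ gs} → .(IsHullFn G⁺ (suc g₀ ∷ gs)) →
    UnitApart (0 ∷ fs) (suc g₀ ∷ gs) → ∀ a → IsDist G v a (lookup gs a)
  adjacent-x-image {gs = gs} hull (close , _) a =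
    recompute-dist (hull-zero-is-distance gs (hull-restrict hull) v gv≡0 a)
    where
      gv≡0 : lookup gs v ≡ 0
      gv≡0 = trans (sym (x-value hull)) (n≤0⇒n≡0 (≤-pred (close zero)))

  x-image-adjacent : ∀ {fs g₀ gs} → .(IsHullFn G⁺ (0 ∷ fs)) → .(IsHullFn G⁺ (suc g₀ ∷ gs)) →
    (∀ a → IsDist G v a (lookup gs a)) → UnitApart (0 ∷ fs) (suc g₀ ∷ gs)
  x-image-adjacent {fs} {g₀} {gs} hullf hullg Dv = close , zero , cong suc g₀≡0
    where
      g₀≡0 : g₀ ≡ 0
      g₀≡0 = trans (x-value hullg) (dist-self-zero (Dv v))
      fa≡1+ga : ∀ a → lookup fs a ≡ suc (lookup gs a)
      fa≡1+ga a = trans (cong (λ h → lookup h a) (zero-at-x hullf)) (lookup-dist-x-old (Dv a))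
      close : ∀ p → ∣ lookup (0 ∷ fs) p - lookup (suc g₀ ∷ gs) p ∣ ≤ 1
      close zero    = subst (λ t → suc t ≤ 1) (sym g₀≡0) ≤-refl
      close (suc a) = subst (λ t → ∣ t - lookup gs a ∣ ≤ 1) (sym (fa≡1+ga a))
                            (≤-reflexive (∣1+n-n∣≡1 (lookup gs a)))

  adjacent-to : ∀ u w → HullAdj G⁺ u w → HullPlusAdj G v (to u) (to w)
  adjacent-to (hullV (zero ∷ fs) hf)   (hullV (zero ∷ gs) hg)   adj =
    unit-apart-irrefl (0 ∷ dist-x-old)
      (subst₂ (λ f g → UnitApart (0 ∷ f) (0 ∷ g)) (zero-at-x hf) (zero-at-x hg) adj)
  adjacent-to (hullV (zero ∷ fs) hf)   (hullV (suc g₀ ∷ gs) hg) adj = adjacent-x-image hg adj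
  adjacent-to (hullV (suc f₀ ∷ fs) hf) (hullV (zero ∷ gs) hg)   adj = adjacent-x-image {fs = gs} hf (unit-apart-sym {f = suc f₀ ∷ fs} {0 ∷ gs} adj)
  adjacent-to (hullV (suc f₀ ∷ fs) hf) (hullV (suc g₀ ∷ gs) hg) adj =
    unit-apart-drop-copy fs gs v
      (subst₂ (λ s t → UnitApart (suc s ∷ fs) (suc t ∷ gs)) (x-value hf) (x-value hg) adj)

  adjacent-from : ∀ u w → HullPlusAdj G v (to u) (to w) → HullAdj G⁺ u w
  adjacent-from (hullV (zero ∷ fs) hf)   (hullV (zero ∷ gs) hg)   ()
  adjacent-from (hullV (zero ∷ fs) hf)   (hullV (suc g₀ ∷ gs) hg) img = x-image-adjacent hf hg img
  adjacent-from (hullV (suc f₀ ∷ fs) hf) (hullV (zero ∷ gs) hg)   img =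
    unit-apart-sym {f = 0 ∷ gs} {suc f₀ ∷ fs} (x-image-adjacent hg hf img)
  adjacent-from (hullV (suc f₀ ∷ fs) hf) (hullV (suc g₀ ∷ gs) hg) adj =
    subst₂ (λ s t → UnitApart (suc s ∷ fs) (suc t ∷ gs)) (sym (x-value hf)) (sym (x-value hg))
      (unit-apart-add-copy fs gs v adj)

  x-embeds : ∀ u → IsImage G⁺ zero u → to u ≡ nothing
  x-embeds (hullV (zero ∷ fs) _)   _   = refl
  x-embeds (hullV (suc f₀ ∷ fs) _) img with W⁺.dist-self-zero (img zero)
  ... | ()

  old-embeds : ∀ z u → IsImage G⁺ (suc z) u → ∃ λ w → to u ≡ just w × IsImage G z w
  old-embeds z (hullV (zero ∷ fs) _)   img with dist-to-x⁻¹ (img zero)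
  ... | _ , () , _
  old-embeds z (hullV (suc f₀ ∷ fs) _) img = _ , refl , λ a → dist-restrict (img (suc a))

lemma6 : (n : ℕ) (G : Graph n) → Connected G → (v : Fin n) → HullIso G v
lemma6 n G connected v = record
  { to       = to
  ; from     = from
  ; to∘from  = to∘from
  ; from∘to  = from∘to
  ; adj-to   = adjacent-to
  ; adj-from = adjacent-from
  ; emb-x    = x-embeds
  ; emb-G    = old-embeds
  }
  where open Pendant G connected v
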